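{- Fix $0 < \epsilon \leq 1$ and integers $\beta \geq 50/\epsilon$ and $\beta^- \geq (1-\frac{\epsilon}{10})\beta$. Let $G=(V,E)$ be a graph, let $H$ be a $(\beta,\beta^-)$-EDCS of $G$, and let $D=D(H)$, $A=A(H)$, $C=C(H)$ be the Gallai–Edmonds decomposition of $H$. Fix an arbitrary maximum matching $M$ of $H$ and an arbitrary maximum matching $M^\star$ of $G$. Call a vertex special if it belongs to $D$ and is either unmatched by $M$ or matched by $M$ to a vertex in $A$. Let $P$ be any augmenting path, i.e., any path among the connected components of $M \cup M^\star$ (whose edges alternate between $M$ and $M^\star$) that starts and ends with an edge of $M^\star$. Call an edge $e=(u,v)$ of $P$ suitable if $e \notin H$, $u \notin A$ and $v \notin A$. Then at least one of the following holds: (T1) $P$ includes a suitable edge $e$ whose endpoints belong to two distinct connected components $O_1$ and $O_2$ of $H[D]$, and the special vertices of $O_1$ and $O_2$ both belong to $P$; (T2) $P$ includes two vertex-disjoint suitable edges.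
   Context: For a graph $K$, $\deg_K(v)$ is the degree of $v$ in $K$, and $K[U]$ is the subgraph induced on vertex set $U$. A subgraph $H=(V,E_H)$ of $G=(V,E)$ is a $(\beta,\beta^-)$-EDCS of $G$ (for integers $\beta>\beta^-\geq 1$) if (P1) every edge $(u,v)\in E_H$ has $\deg_H(u)+\deg_H(v)\leq\beta$, and (P2) every edge $(u,v)\in E\setminus E_H$ has $\deg_H(u)+\deg_H(v)\geq\beta^-$. The Gallai–Edmonds decomposition of a graph $H$ partitions its vertex set into: $D(H)$, the set of vertices $v$ such that some maximum matching of $H$ leaves $v$ unmatched; $A(H)$, the vertices not in $D(H)$ that are adjacent in $H$ to some vertex of $D(H)$; and $C(H)$, all remaining vertices. Each connected component of $H[D]$ contains exactly one special vertex (with respect to $M$). -}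

module Defs where

open import Data.Bool using (Bool; true; false; if_then_else_; _∧_)
open import Data.Nat using (ℕ; zero; suc; _+_; _*_; _≤_; _<ᵇ_; _%_)
open import Data.Fin using (Fin; zero; suc; toℕ; inject₁; fromℕ)
open import Data.Integer using (+_)
open import Data.Product using (Σ; ∃; _×_; _,_)
open import Data.Sum using (_⊎_)
open import Relation.Nullary using (¬_)
open import Relation.Binary.PropositionalEquality using (_≡_; _≢_)
open import Function using (_∘_; Injective)
import Data.Rational as ℚ
open ℚ using (ℚ; 0ℚ; 1ℚ)
open import Data.Rational.Properties using (pos⇒nonZero)

ℕ→ℚ : ℕ → ℚ
ℕ→ℚ k = (+ k) ℚ./ 1

BetaLarge : (ε : ℚ) → 0ℚ ℚ.< ε → ℕ → Set
BetaLarge ε ε>0 β =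
  ((ℕ→ℚ 50) ℚ.÷ ε) {{pos⇒nonZero ε {{ℚ.positive ε>0}}}} ℚ.≤ ℕ→ℚ β

BetaMinusLarge : ℚ → ℕ → ℕ → Set
BetaMinusLarge ε β β⁻ = (1ℚ ℚ.- ε ℚ.* ((+ 1) ℚ./ 10)) ℚ.* ℕ→ℚ β ℚ.≤ ℕ→ℚ β⁻

Graph : ℕ → Set
Graph n = Fin n → Fin n → Bool

IsGraph : ∀ {n} → Graph n → Set
IsGraph K = (∀ u v → K u v ≡ K v u) × (∀ v → K v v ≡ false)

count : ∀ {n} → (Fin n → Bool) → ℕ
count {zero}  f = 0
count {suc n} f = (if f zero then 1 else 0) + count (f ∘ suc)

sumFin : ∀ {n} → (Fin n → ℕ) → ℕ
sumFin {zero}  f = 0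
sumFin {suc n} f = f zero + sumFin (f ∘ suc)

deg : ∀ {n} → Graph n → Fin n → ℕ
deg K v = count (K v)

numEdges : ∀ {n} → Graph n → ℕ
numEdges K = sumFin (λ u → count (λ v → K u v ∧ (toℕ u <ᵇ toℕ v)))

IsSubgraph : ∀ {n} → Graph n → Graph n → Set
IsSubgraph H G = IsGraph H × (∀ u v → H u v ≡ true → G u v ≡ true)

IsEDCS : ∀ {n} → ℕ → ℕ → Graph n → Graph n → Set
IsEDCS β β⁻ G H =
  IsSubgraph H G
  × (∀ u v → H u v ≡ true → deg H u + deg H v ≤ β)
  × (∀ u v → G u v ≡ true → H u v ≡ false → β⁻ ≤ deg H u + deg H v)

IsMatching : ∀ {n} → Graph n → Graph n → Set
IsMatching K M =
  IsSubgraph M K × (∀ v u w → M v u ≡ true → M v w ≡ true → u ≡ w)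

IsMaxMatching : ∀ {n} → Graph n → Graph n → Set
IsMaxMatching K M =
  IsMatching K M × (∀ M′ → IsMatching K M′ → numEdges M′ ≤ numEdges M)

Unmatched : ∀ {n} → Graph n → Fin n → Set
Unmatched M v = ∀ w → M v w ≡ false

GE-D : ∀ {n} → Graph n → Fin n → Set
GE-D H v = ∃ λ M → IsMaxMatching H M × Unmatched M v

GE-A : ∀ {n} → Graph n → Fin n → Set
GE-A H v = ¬ GE-D H v × ∃ λ u → GE-D H u × H v u ≡ true

GE-C : ∀ {n} → Graph n → Fin n → Set
GE-C H v = ¬ GE-D H v × ¬ GE-A H v

data SameCompD {n} (H : Graph n) : Fin n → Fin n → Set where
  here : ∀ {u} → GE-D H u → SameCompD H u u
  step : ∀ {u w v} → GE-D H u → H u w ≡ true → SameCompD H w v → SameCompD H u v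

Special : ∀ {n} → Graph n → Graph n → Fin n → Set
Special H M v =
  GE-D H v × (Unmatched M v ⊎ ∃ λ w → M v w ≡ true × GE-A H w)

-- Augmenting paths: p 0, p 1, …, p (2k+1), edges (p i, p (i+1)) for
-- i : Fin (2k+1); even-indexed edges in M⋆, odd-indexed edges in M,
-- distinct vertices, both ends unmatched by M.

PathLen : ℕ → ℕ
PathLen k = suc (2 * k)

src : ∀ {n} k → (Fin (suc (PathLen k)) → Fin n) → Fin (PathLen k) → Fin n
src k p i = p (inject₁ i)

tgt : ∀ {n} k → (Fin (suc (PathLen k)) → Fin n) → Fin (PathLen k) → Fin n
tgt k p i = p (suc i)

IsAugPath : ∀ {n} → Graph n → Graph n → (k : ℕ) → (Fin (suc (PathLen k)) → Fin n) → Set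
IsAugPath M M⋆ k p =
  Injective _≡_ _≡_ p
  × (∀ i → toℕ i % 2 ≡ 0 → M⋆ (src k p i) (tgt k p i) ≡ true)
  × (∀ i → toℕ i % 2 ≡ 1 → M (src k p i) (tgt k p i) ≡ true)
  × Unmatched M (p zero)
  × Unmatched M (p (fromℕ (PathLen k)))

OnPath : ∀ {n} k → (Fin (suc (PathLen k)) → Fin n) → Fin n → Set
OnPath k p v = ∃ λ j → p j ≡ v

Suitable : ∀ {n} k → Graph n → (Fin (suc (PathLen k)) → Fin n) → Fin (PathLen k) → Set
Suitable k H p i =
  H (src k p i) (tgt k p i) ≡ false × ¬ GE-A H (src k p i) × ¬ GE-A H (tgt k p i)

T1 : ∀ {n} k → Graph n → Graph n → (Fin (suc (PathLen k)) → Fin n) → Set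
T1 k H M p = Σ (Fin (PathLen k)) λ i →
  Suitable k H p i
  × GE-D H (src k p i) × GE-D H (tgt k p i)
  × ¬ SameCompD H (src k p i) (tgt k p i)
  × (∃ λ s₁ → Special H M s₁ × SameCompD H (src k p i) s₁ × OnPath k p s₁)
  × (∃ λ s₂ → Special H M s₂ × SameCompD H (tgt k p i) s₂ × OnPath k p s₂)

T2 : ∀ {n} k → Graph n → (Fin (suc (PathLen k)) → Fin n) → Set
T2 k H p = Σ (Fin (PathLen k)) λ i → Σ (Fin (PathLen k)) λ j →
  Suitable k H p i × Suitable k H p j
  × src k p i ≢ src k p j × src k p i ≢ tgt k p j
  × tgt k p i ≢ src k p j × tgt k p i ≢ tgt k p j

{-# OPTIONS --safe #-}
module Submission where

-- Walk along P from its first vertex, which is free in M and hence special. While the next M⋆-edge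
-- lies in H, or leads into A, the walk stays in a component of H[D] whose special vertex it has
-- already passed (after a vertex of A it continues at that vertex's M-partner, which is special in
-- its own component). A component of H[D] has at most one special vertex, which is the Gallai–Edmonds
-- part of the argument, proved by induction on |M| by deleting vertices of A. As the last vertex of P
-- is free, the walk stops at a suitable edge. Walking from the other end gives a second suitable edge:
-- if it is the same edge, its ends lie in distinct components whose special vertices are on P (T1),
-- and otherwise the two edges are vertex-disjoint (T2).

open import Defs
open import Data.Bool using (Bool; true; false; not; _∧_; _∨_; if_then_else_)
import Data.Bool as Bool
import Data.Bool.Properties as BoolP
open import Data.Nat using (ℕ; zero; suc; _+_; _*_; _∸_; _<_; _≤_; _<ᵇ_; _%_; z≤n; s≤s)
import Data.Nat.Properties as ℕP
open import Data.Nat.DivMod using ([m+n]%n≡m%n)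
open import Data.Fin using (Fin; zero; suc; toℕ; inject₁; fromℕ; fromℕ<)
import Data.Fin.Properties as FinP
open FinP using (_≟_)
open import Data.List using (List; []; _∷_; _++_)
open import Data.List.Membership.Propositional using (_∈_; _∉_)
open import Data.List.Membership.Propositional.Properties using (∈-++⁻)
open import Data.List.Relation.Unary.Any using (here; there)
import Data.List.Relation.Unary.Any as Any
open import Data.Product using (∃; _×_; _,_; proj₁; proj₂; swap)
open import Data.Sum using (_⊎_; inj₁; inj₂; [_,_])
import Data.Sum as Sum
open import Data.Empty using (⊥; ⊥-elim)
open import Function using (_∘_; Injective)
open import Function.Bundles using (mk⇔)
open import Relation.Nullary using (¬_; Dec; yes; no; does; proof)
open import Relation.Nullary.Reflects using (Reflects; invert)
open import Relation.Nullary.Decidable using (_×-dec_; _⊎-dec_; _→-dec_; dec-true; dec-false; does-⇔)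
open import Relation.Binary using (tri<; tri≈; tri>)
open import Relation.Binary.PropositionalEquality using (_≡_; _≢_; refl; sym; trans; cong; cong₂; subst; subst₂)
import Data.Rational as ℚ

private variable
  n : ℕ
  H K K′ M N : Graph n
  a c s u v w x y z : Fin n
  b l t : Bool
  vs : List (Fin n)

true≢false : true ≢ false
true≢false ()

∨≡true : ∀ {p q} → p ∨ q ≡ true → p ≡ true ⊎ q ≡ true
∨≡true {true}  _ = inj₁ refl
∨≡true {false} e = inj₂ e

∧≡true : ∀ {p q} → p ∧ q ≡ true → p ≡ true × q ≡ true
∧≡true {true} e = refl , e

<ᵇ-true : ∀ {m k} → m < k → (m <ᵇ k) ≡ true
<ᵇ-true {m} {k} = dec-true (m ℕP.<? k)

<ᵇ-false : ∀ {m k} → k ≤ m → (m <ᵇ k) ≡ false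
<ᵇ-false {m} {k} k≤m = dec-false (m ℕP.<? k) (ℕP.≤⇒≯ k≤m)

edge-sym : IsGraph K → K u v ≡ true → K v u ≡ true
edge-sym {u = u} {v} (K-sym , _) e = trans (K-sym v u) e

edge-≢ : IsGraph K → K u v ≡ true → u ≢ v
edge-≢ {u = u} (_ , K-loopless) e refl = true≢false (trans (sym e) (K-loopless u))

count-cong : {f g : Fin n → Bool} → (∀ i → f i ≡ g i) → count f ≡ count g
count-cong {zero}  e = refl
count-cong {suc n} e = cong₂ _+_ (cong (if_then 1 else 0) (e zero)) (count-cong (e ∘ suc))

sumFin-cong : {f g : Fin n → ℕ} → (∀ i → f i ≡ g i) → sumFin f ≡ sumFin g
sumFin-cong {zero}  e = refl
sumFin-cong {suc n} e = cong₂ _+_ (e zero) (sumFin-cong (e ∘ suc))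

count-≡suc : {f g : Fin n → Bool} (c : Fin n) → f c ≡ true → g c ≡ false →
  (∀ i → i ≢ c → f i ≡ g i) → count f ≡ suc (count g)
count-≡suc {suc n} zero fc gc e rewrite fc | gc = cong suc (count-cong λ i → e (suc i) λ ())
count-≡suc {suc n} (suc c) fc gc e rewrite e zero (λ ()) =
  trans (cong (_ +_) (count-≡suc c fc gc λ i i≢c → e (suc i) (i≢c ∘ FinP.suc-injective))) (ℕP.+-suc _ _)

sumFin-≡suc : {f g : Fin n → ℕ} (c : Fin n) → f c ≡ suc (g c) →
  (∀ i → i ≢ c → f i ≡ g i) → sumFin f ≡ suc (sumFin g)
sumFin-≡suc {suc n} {g = g} zero fc e rewrite fc = cong (λ m → suc (g zero + m)) (sumFin-cong λ i → e (suc i) λ ())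
sumFin-≡suc {suc n} (suc c) fc e rewrite e zero (λ ()) =
  trans (cong (_ +_) (sumFin-≡suc c fc λ i i≢c → e (suc i) (i≢c ∘ FinP.suc-injective))) (ℕP.+-suc _ _)

numEdges-cong : (∀ u v → K u v ≡ K′ u v) → numEdges K ≡ numEdges K′
numEdges-cong e = sumFin-cong λ u → count-cong λ v → cong (_∧ _) (e u v)

AgreeOffEdge : Fin n → Fin n → Graph n → Graph n → Set
AgreeOffEdge a c K K′ = ∀ u v → ¬ (u ≡ a × v ≡ c) → ¬ (u ≡ c × v ≡ a) → K u v ≡ K′ u v

-- numEdges counts the edge {a, c} in row min(a, c) only.
numEdges-≡suc-< : toℕ a < toℕ c → AgreeOffEdge a c K K′ → K a c ≡ true → K′ a c ≡ false →
  numEdges K ≡ suc (numEdges K′)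
numEdges-≡suc-< {a = a} {c} {K} {K′} a<c agree Kac K′ac = sumFin-≡suc a row-a other-row
  where
  a≢c : a ≢ c
  a≢c refl = ℕP.<-irrefl refl a<c
  row-a : count (λ v → K a v ∧ (toℕ a <ᵇ toℕ v)) ≡ suc (count (λ v → K′ a v ∧ (toℕ a <ᵇ toℕ v)))
  row-a = count-≡suc c (cong₂ _∧_ Kac (<ᵇ-true a<c)) (cong (_∧ _) K′ac)
            λ v v≢c → cong (_∧ _) (agree a v (v≢c ∘ proj₂) (a≢c ∘ proj₁))
  other-row : ∀ u → u ≢ a → count (λ v → K u v ∧ (toℕ u <ᵇ toℕ v)) ≡ count (λ v → K′ u v ∧ (toℕ u <ᵇ toℕ v))
  other-row u u≢a = count-cong entry
    where
    entry : ∀ v → K u v ∧ (toℕ u <ᵇ toℕ v) ≡ K′ u v ∧ (toℕ u <ᵇ toℕ v)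
    entry v with u ≟ c | v ≟ a
    ... | yes refl | yes refl rewrite <ᵇ-false (ℕP.<⇒≤ a<c) =
      trans (BoolP.∧-zeroʳ _) (sym (BoolP.∧-zeroʳ _))
    ... | yes _    | no v≢a = cong (_∧ _) (agree u v (u≢a ∘ proj₁) (v≢a ∘ proj₂))
    ... | no u≢c   | _      = cong (_∧ _) (agree u v (u≢a ∘ proj₁) (u≢c ∘ proj₁))

numEdges-≡suc : a ≢ c → AgreeOffEdge a c K K′ →
  K a c ≡ true → K c a ≡ true → K′ a c ≡ false → K′ c a ≡ false → numEdges K ≡ suc (numEdges K′)
numEdges-≡suc {a = a} {c} a≢c agree Kac Kca K′ac K′ca with ℕP.<-cmp (toℕ a) (toℕ c)
... | tri< a<c _ _ = numEdges-≡suc-< a<c agree Kac K′ac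
... | tri≈ _ a≡c _ = ⊥-elim (a≢c (FinP.toℕ-injective a≡c))
... | tri> _ _ c<a = numEdges-≡suc-< c<a (λ u v p q → agree u v q p) Kca K′ca

SameEdge : Fin n → Fin n → Fin n → Fin n → Set
SameEdge a c u v = (u ≡ a × v ≡ c) ⊎ (u ≡ c × v ≡ a)

sameEdge? : ∀ (a c u v : Fin n) → Dec (SameEdge a c u v)
sameEdge? a c u v = (u ≟ a ×-dec v ≟ c) ⊎-dec (u ≟ c ×-dec v ≟ a)

isEdge : Fin n → Fin n → Fin n → Fin n → Bool
isEdge a c u v = does (sameEdge? a c u v)

isEdge-ac : isEdge a c a c ≡ true
isEdge-ac {a = a} {c} = dec-true (sameEdge? a c a c) (inj₁ (refl , refl))

isEdge-ca : isEdge a c c a ≡ true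
isEdge-ca {a = a} {c} = dec-true (sameEdge? a c c a) (inj₂ (refl , refl))

isEdge-off : ¬ (u ≡ a × v ≡ c) → ¬ (u ≡ c × v ≡ a) → isEdge a c u v ≡ false
isEdge-off {u = u} {a} {v} {c} ¬ac ¬ca = dec-false (sameEdge? a c u v) [ ¬ac , ¬ca ]

isEdge⁻ : isEdge a c u v ≡ true → SameEdge a c u v
isEdge⁻ {a = a} {c} {u} {v} e = invert (subst (Reflects _) e (proof (sameEdge? a c u v)))

isEdge-sym : ∀ (a c u v : Fin n) → isEdge a c u v ≡ isEdge a c v u
isEdge-sym a c u v = does-⇔ (mk⇔ flip flip) (sameEdge? a c u v) (sameEdge? a c v u)
  where
  flip : ∀ {p q} → SameEdge a c p q → SameEdge a c q p
  flip = [ inj₂ ∘ swap , inj₁ ∘ swap ]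

module _ (mM : IsMatching H M) where

  matching-isGraph : IsGraph M
  matching-isGraph = proj₁ (proj₁ mM)

  matching-sym : M u v ≡ true → M v u ≡ true
  matching-sym = edge-sym matching-isGraph

  matching-≢ : M u v ≡ true → u ≢ v
  matching-≢ = edge-≢ matching-isGraph

  matching⊆ : ∀ u v → M u v ≡ true → H u v ≡ true
  matching⊆ = proj₂ (proj₁ mM)

  matching-unique : M v u ≡ true → M v w ≡ true → u ≡ w
  matching-unique = proj₂ mM _ _ _

  unmatched-partner : Unmatched M u → M v u ≡ false
  unmatched-partner {u = u} {v} u-free = trans (proj₁ matching-isGraph v u) (u-free v)

sub-matching : (∀ u v → K u v ≡ true → H u v ≡ true) → IsMatching K M → IsMatching H M
sub-matching K⊆H mM = (matching-isGraph mM , λ u v → K⊆H u v ∘ matching⊆ mM u v) , proj₂ mM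

opaque
  removeEdge : Graph n → Fin n → Fin n → Graph n
  removeEdge K a c u v = K u v ∧ not (isEdge a c u v)

  addEdge : Graph n → Fin n → Fin n → Graph n
  addEdge K a c u v = K u v ∨ isEdge a c u v

  isolate : Graph n → Fin n → Graph n
  isolate K a u v = K u v ∧ not (does (u ≟ a) ∨ does (v ≟ a))

  removeEdge-off : ¬ (u ≡ a × v ≡ c) → ¬ (u ≡ c × v ≡ a) → removeEdge K a c u v ≡ K u v
  removeEdge-off ¬ac ¬ca rewrite isEdge-off ¬ac ¬ca = BoolP.∧-identityʳ _

  addEdge-off : ¬ (u ≡ a × v ≡ c) → ¬ (u ≡ c × v ≡ a) → addEdge K a c u v ≡ K u v
  addEdge-off ¬ac ¬ca rewrite isEdge-off ¬ac ¬ca = BoolP.∨-identityʳ _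

  removeEdge-ac : removeEdge K a c a c ≡ false
  removeEdge-ac {a = a} {c} rewrite isEdge-ac {a = a} {c} = BoolP.∧-zeroʳ _

  removeEdge-ca : removeEdge K a c c a ≡ false
  removeEdge-ca {a = a} {c} rewrite isEdge-ca {a = a} {c} = BoolP.∧-zeroʳ _

  addEdge-ac : addEdge K a c a c ≡ true
  addEdge-ac {a = a} {c} rewrite isEdge-ac {a = a} {c} = BoolP.∨-zeroʳ _

  addEdge-ca : addEdge K a c c a ≡ true
  addEdge-ca {a = a} {c} rewrite isEdge-ca {a = a} {c} = BoolP.∨-zeroʳ _

  isolate-off : u ≢ a → v ≢ a → isolate K a u v ≡ K u v
  isolate-off {u = u} {a} {v} u≢a v≢a rewrite dec-false (u ≟ a) u≢a | dec-false (v ≟ a) v≢a =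
    BoolP.∧-identityʳ _

  isolate-a : isolate K a a v ≡ false
  isolate-a {a = a} rewrite dec-true (a ≟ a) refl = BoolP.∧-zeroʳ _

  isolate⊆ : isolate K a u v ≡ true → K u v ≡ true
  isolate⊆ = proj₁ ∘ ∧≡true

  numEdges-removeEdge : IsGraph K → K a c ≡ true → numEdges K ≡ suc (numEdges (removeEdge K a c))
  numEdges-removeEdge {K = K} gK Kac =
    numEdges-≡suc (edge-≢ gK Kac) (λ u v p q → sym (removeEdge-off {K = K} p q))
      Kac (edge-sym gK Kac) (removeEdge-ac {K = K}) (removeEdge-ca {K = K})

  numEdges-addEdge : IsGraph K → a ≢ c → K a c ≡ false → numEdges (addEdge K a c) ≡ suc (numEdges K)
  numEdges-addEdge {K = K} {a} {c} (K-sym , _) a≢c Kac =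
    numEdges-≡suc a≢c (λ u v p q → addEdge-off {K = K} p q)
      (addEdge-ac {K = K}) (addEdge-ca {K = K}) Kac (trans (K-sym c a) Kac)

  removeEdge-isGraph : ∀ a c → IsGraph K → IsGraph (removeEdge K a c)
  removeEdge-isGraph a c (K-sym , K-loopless) =
    (λ u v → cong₂ _∧_ (K-sym u v) (cong not (isEdge-sym a c u v))) , (λ v → cong (_∧ _) (K-loopless v))

  addEdge-isGraph : a ≢ c → IsGraph K → IsGraph (addEdge K a c)
  addEdge-isGraph {a = a} {c} a≢c (K-sym , K-loopless) =
    (λ u v → cong₂ _∨_ (K-sym u v) (isEdge-sym a c u v)) ,
    (λ v → cong₂ _∨_ (K-loopless v) (isEdge-off {u = v} {a = a} {v = v} {c = c} (λ { (refl , refl) → a≢c refl }) (λ { (refl , refl) → a≢c refl })))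

  isolate-isGraph : IsGraph K → IsGraph (isolate K a)
  isolate-isGraph {a = a} (K-sym , K-loopless) =
    (λ u v → cong₂ _∧_ (K-sym u v) (cong not (BoolP.∨-comm (does (u ≟ a)) (does (v ≟ a))))) ,
    (λ v → cong (_∧ _) (K-loopless v))

  removeEdge⊆ : removeEdge K a c u v ≡ true → K u v ≡ true
  removeEdge⊆ = proj₁ ∘ ∧≡true

  removeEdge-matching : ∀ a c → IsMatching H M → IsMatching H (removeEdge M a c)
  removeEdge-matching a c mM =
    (removeEdge-isGraph a c (matching-isGraph mM) , λ u v → matching⊆ mM u v ∘ proj₁ ∘ ∧≡true) ,
    (λ v u w e₁ e₂ → matching-unique mM (proj₁ (∧≡true e₁)) (proj₁ (∧≡true e₂)))

  addEdge-matching : IsGraph H → IsMatching H M → H a c ≡ true → Unmatched M a → Unmatched M c →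
    IsMatching H (addEdge M a c)
  addEdge-matching {H = H} {M = M} {a} {c} gH mM Hac a-free c-free =
    (addEdge-isGraph a≢c (matching-isGraph mM) , sub) , unique
    where
    a≢c : a ≢ c
    a≢c = edge-≢ gH Hac
    sub : ∀ u v → addEdge M a c u v ≡ true → H u v ≡ true
    sub u v e with ∨≡true e
    ... | inj₁ Muv = matching⊆ mM u v Muv
    ... | inj₂ ac with isEdge⁻ {a = a} {c} {u} {v} ac
    ...   | inj₁ (refl , refl) = Hac
    ...   | inj₂ (refl , refl) = edge-sym gH Hac
    matched-off : ∀ {v u w} → M v u ≡ true → isEdge a c v w ≡ true → ⊥
    matched-off {v} {u} {w} Mvu vw with isEdge⁻ {a = a} {c} {v} {w} vw
    ... | inj₁ (refl , refl) = true≢false (trans (sym Mvu) (a-free u))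
    ... | inj₂ (refl , refl) = true≢false (trans (sym Mvu) (c-free u))
    unique : ∀ v u w → addEdge M a c v u ≡ true → addEdge M a c v w ≡ true → u ≡ w
    unique v u w e₁ e₂ with ∨≡true e₁ | ∨≡true e₂
    ... | inj₁ Mvu | inj₁ Mvw = matching-unique mM Mvu Mvw
    ... | inj₁ Mvu | inj₂ vw = ⊥-elim (matched-off {v} {u} {w} Mvu vw)
    ... | inj₂ vu  | inj₁ Mvw = ⊥-elim (matched-off {v} {w} {u} Mvw vu)
    ... | inj₂ vu  | inj₂ vw with isEdge⁻ {a = a} {c} {v} {u} vu | isEdge⁻ {a = a} {c} {v} {w} vw
    ...   | inj₁ (refl , refl) | inj₁ (_ , refl) = refl
    ...   | inj₁ (refl , refl) | inj₂ (v≡c , _) = ⊥-elim (a≢c v≡c)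
    ...   | inj₂ (refl , refl) | inj₁ (v≡a , _) = ⊥-elim (a≢c (sym v≡a))
    ...   | inj₂ (refl , refl) | inj₂ (_ , refl) = refl

  removeEdge-freesˡ : IsMatching H M → M a c ≡ true → Unmatched (removeEdge M a c) a
  removeEdge-freesˡ {M = M} {a} {c} mM Mac w with M a w in Maw
  ... | false = refl
  ... | true with matching-unique mM Mac Maw
  ...   | refl = cong not (isEdge-ac {a = a} {c})

  removeEdge-freesʳ : IsMatching H M → M a c ≡ true → Unmatched (removeEdge M a c) c
  removeEdge-freesʳ {M = M} {a} {c} mM Mac w with M c w in Mcw
  ... | false = refl
  ... | true with matching-unique mM (matching-sym mM Mac) Mcw
  ...   | refl = cong not (isEdge-ca {a = a} {c})

  removeEdge-unmatched : Unmatched M z → Unmatched (removeEdge M a c) z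
  removeEdge-unmatched z-free w rewrite z-free w = refl


maximum-≤ : IsMaxMatching H M → IsMatching H K → numEdges M ≤ numEdges K → IsMaxMatching H K
maximum-≤ mx mK M≤K = mK , λ M′ mM′ → ℕP.≤-trans (proj₂ mx M′ mM′) M≤K

maximum-≮ : IsMaxMatching H M → IsMatching H K → numEdges M < numEdges K → ⊥
maximum-≮ mx mK M<K = ℕP.<⇒≱ M<K (proj₂ mx _ mK)

-- Alternating M H b l x z vs: a path from x to z in H through the distinct vertices vs whose
-- edges lie alternately in and out of M; the first edge is in M iff b, the last iff l.
data Alternating (M H : Graph n) : Bool → Bool → Fin n → Fin n → List (Fin n) → Set where
  single : M x y ≡ b → H x y ≡ true → x ≢ y → Alternating M H b b x y (x ∷ y ∷ [])
  cons   : M x y ≡ b → H x y ≡ true → x ∉ vs → Alternating M H (not b) l y z vs →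
           Alternating M H b l x z (x ∷ vs)

alternating-start∈ : Alternating M H b l x z vs → x ∈ vs
alternating-start∈ (single _ _ _) = here refl
alternating-start∈ (cons _ _ _ _) = here refl

alternating-end∈ : Alternating M H b l x z vs → z ∈ vs
alternating-end∈ (single _ _ _) = there (here refl)
alternating-end∈ (cons _ _ _ P) = there (alternating-end∈ P)

alternating-ends-≢ : Alternating M H b l x z vs → x ≢ z
alternating-ends-≢ (single _ _ x≢z) = x≢z
alternating-ends-≢ (cons _ _ x∉ P) refl = x∉ (alternating-end∈ P)

alternating-cong : (∀ u v → u ∈ vs → v ∈ vs → K u v ≡ M u v) → Alternating M H b l x z vs →
  Alternating K H b l x z vs
alternating-cong agree (single Mxy Hxy x≢y) =
  single (trans (agree _ _ (here refl) (there (here refl))) Mxy) Hxy x≢y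
alternating-cong agree (cons Mxy Hxy x∉ P) =
  cons (trans (agree _ _ (here refl) (there (alternating-start∈ P))) Mxy) Hxy x∉
       (alternating-cong (λ u v u∈ v∈ → agree u v (there u∈) (there v∈)) P)

alternating-snoc : Alternating M H b l x z vs → M z y ≡ not l → H z y ≡ true → y ∉ vs →
  Alternating M H b (not l) x y (vs ++ y ∷ [])
alternating-snoc (single Mxz Hxz x≢z) Mzy Hzy y∉ =
  cons Mxz Hxz (λ { (here x≡z) → x≢z x≡z ; (there (here x≡y)) → y∉ (here (sym x≡y)) })
    (single Mzy Hzy λ z≡y → y∉ (there (here (sym z≡y))))
alternating-snoc {vs = x ∷ vs} {y = y} (cons Mxx′ Hxx′ x∉ P) Mzy Hzy y∉ =
  cons Mxx′ Hxx′ x∉′ (alternating-snoc P Mzy Hzy (y∉ ∘ there))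
  where
  x∉′ : x ∉ vs ++ y ∷ []
  x∉′ x∈ with ∈-++⁻ vs x∈
  ... | inj₁ x∈vs = x∉ x∈vs
  ... | inj₂ (here refl) = y∉ (here refl)

alternating-unmatched : IsMatching H M → Alternating M H b l x z vs → v ∈ vs → Unmatched M v →
  (v ≡ x × b ≡ false) ⊎ (v ≡ z × l ≡ false)
alternating-unmatched mM (single Mxz _ _) (here refl) v-free = inj₁ (refl , trans (sym Mxz) (v-free _))
alternating-unmatched mM (single Mxz _ _) (there (here refl)) v-free =
  inj₂ (refl , trans (sym Mxz) (unmatched-partner mM v-free))
alternating-unmatched mM (cons Mxy _ _ _) (here refl) v-free = inj₁ (refl , trans (sym Mxy) (v-free _))
alternating-unmatched {b = b} mM (cons Mxy _ _ P) (there v∈) v-free with alternating-unmatched mM P v∈ v-free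
... | inj₁ (refl , ¬b≡false) =
  ⊥-elim (true≢false (trans (sym (BoolP.not-injective {b} ¬b≡false)) (trans (sym Mxy) (unmatched-partner mM v-free))))
... | inj₂ at-end = inj₂ at-end

alternating-suffix : IsMatching H M → Alternating M H b l x z vs → v ∈ vs → M v w ≡ true →
  (∃ λ vs′ → Alternating M H true l v z vs′) ⊎ (∃ λ vs′ → Alternating M H true l w z vs′) ⊎
  (v ≡ x × b ≡ false) ⊎ (v ≡ z × l ≡ false)
alternating-suffix {b = true}  mM P@(single _ _ _) (here refl) Mvw = inj₁ (_ , P)
alternating-suffix {b = false} mM (single _ _ _) (here refl) Mvw = inj₂ (inj₂ (inj₁ (refl , refl)))
alternating-suffix {b = true}  mM P@(single Mxz _ _) (there (here refl)) Mvw
  with refl ← matching-unique mM Mvw (matching-sym mM Mxz) = inj₂ (inj₁ (_ , P))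
alternating-suffix {b = false} mM (single _ _ _) (there (here refl)) Mvw = inj₂ (inj₂ (inj₂ (refl , refl)))
alternating-suffix {b = true}  mM P@(cons _ _ _ _) (here refl) Mvw = inj₁ (_ , P)
alternating-suffix {b = false} mM (cons _ _ _ _) (here refl) Mvw = inj₂ (inj₂ (inj₁ (refl , refl)))
alternating-suffix mM P@(cons Mxy _ _ Q) (there v∈) Mvw with alternating-suffix mM Q v∈ Mvw
... | inj₁ from-v = inj₁ from-v
... | inj₂ (inj₁ from-w) = inj₂ (inj₁ from-w)
... | inj₂ (inj₂ (inj₂ at-end)) = inj₂ (inj₂ (inj₂ at-end))
... | inj₂ (inj₂ (inj₁ (refl , ¬b≡false)))
  with refl ← BoolP.not-injective {_} {true} ¬b≡false
  with refl ← matching-unique mM Mvw (matching-sym mM Mxy) = inj₂ (inj₁ (_ , P))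

-- Switching M along P changes |M| by +1 if both end edges of P are outside M, by −1 if both
-- are in M, and leaves it unchanged otherwise.
record Switched (H M : Graph n) (b l : Bool) (x z : Fin n) (vs : List (Fin n)) : Set where
  field
    matching   : Graph n
    isMatching : IsMatching H matching
    agree-off  : ∀ v → v ∉ vs → ∀ w → matching v w ≡ M v w
    start-free : b ≡ true → Unmatched matching x
    end-free   : l ≡ true → Unmatched matching z
    size       : numEdges matching + (if b ∧ l then 1 else 0) ≡ numEdges M + (if b ∨ l then 0 else 1)

size-after-removing : ∀ l {k m m₀} → m ≡ suc m₀ → k + 0 ≡ m₀ + (if l then 0 else 1) →
  k + (if l then 1 else 0) ≡ m + 0
size-after-removing true  {k} {m₀ = m₀} refl k≡m₀ =
  trans (ℕP.+-comm k 1) (cong suc (trans (sym (ℕP.+-identityʳ k)) k≡m₀))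
size-after-removing false {k} {m₀ = m₀} refl k≡m₀+1 =
  trans k≡m₀+1 (trans (ℕP.+-comm m₀ 1) (cong suc (sym (ℕP.+-identityʳ m₀))))

size-after-adding : ∀ l {k k₀ m} → k ≡ suc k₀ → k₀ + (if l then 1 else 0) ≡ m + 0 →
  k + 0 ≡ m + (if l then 0 else 1)
size-after-adding true  {k₀ = k₀} refl k₀+1≡m =
  trans (ℕP.+-identityʳ (suc k₀)) (trans (ℕP.+-comm 1 k₀) k₀+1≡m)
size-after-adding false {k₀ = k₀} {m} refl k₀≡m =
  trans (ℕP.+-identityʳ (suc k₀)) (trans (cong suc (trans (sym (ℕP.+-identityʳ k₀)) (trans k₀≡m (ℕP.+-identityʳ m))))
                                          (ℕP.+-comm 1 m))

switch-single-in : IsMatching H M → M x y ≡ true → Switched H M true true x y (x ∷ y ∷ [])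
switch-single-in {M = M} {x} {y} mM Mxy = record
  { matching   = removeEdge M x y
  ; isMatching = removeEdge-matching x y mM
  ; agree-off  = λ v v∉ w → removeEdge-off (λ { (refl , _) → v∉ (here refl) }) (λ { (refl , _) → v∉ (there (here refl)) })
  ; start-free = λ _ → removeEdge-freesˡ mM Mxy
  ; end-free   = λ _ → removeEdge-freesʳ mM Mxy
  ; size       = trans (ℕP.+-comm _ 1) (trans (sym (numEdges-removeEdge (matching-isGraph mM) Mxy)) (sym (ℕP.+-identityʳ _)))
  }

switch-single-out : IsGraph H → IsMatching H M → M x y ≡ false → H x y ≡ true →
  Unmatched M x → Unmatched M y → Switched H M false false x y (x ∷ y ∷ [])
switch-single-out {M = M} {x} {y} gH mM Mxy Hxy x-free y-free = record
  { matching   = addEdge M x y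
  ; isMatching = addEdge-matching gH mM Hxy x-free y-free
  ; agree-off  = λ v v∉ w → addEdge-off (λ { (refl , _) → v∉ (here refl) }) (λ { (refl , _) → v∉ (there (here refl)) })
  ; start-free = λ ()
  ; end-free   = λ ()
  ; size       = trans (ℕP.+-identityʳ _) (trans (numEdges-addEdge (matching-isGraph mM) (edge-≢ gH Hxy) Mxy) (ℕP.+-comm 1 _))
  }

switch-cons-in : IsMatching H M → M x y ≡ true → x ∉ vs → y ∈ vs →
  Switched H (removeEdge M x y) false l y z vs → Switched H M true l x z (x ∷ vs)
switch-cons-in {M = M} {x} {y} {l = l} mM Mxy x∉ y∈ R = record
  { matching   = R.matching
  ; isMatching = R.isMatching
  ; agree-off  = λ v v∉ w → trans (R.agree-off v (v∉ ∘ there) w)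
                   (removeEdge-off (λ { (refl , _) → v∉ (here refl) }) (λ { (refl , _) → v∉ (there y∈) }))
  ; start-free = λ _ w → trans (R.agree-off x x∉ w) (removeEdge-freesˡ mM Mxy w)
  ; end-free   = R.end-free
  ; size       = size-after-removing l (numEdges-removeEdge (matching-isGraph mM) Mxy) R.size
  }
  where module R = Switched R

switch-cons-out : IsGraph H → M x y ≡ false → H x y ≡ true → x ∉ vs → y ∈ vs → z ∈ vs → y ≢ z →
  Unmatched M x → Switched H M true l y z vs → Switched H M false l x z (x ∷ vs)
switch-cons-out {M = M} {x} {y} {l = l} gH Mxy Hxy x∉ y∈ z∈ y≢z x-free R = record
  { matching   = addEdge R.matching x y
  ; isMatching = addEdge-matching gH R.isMatching Hxy x-free′ (R.start-free refl)
  ; agree-off  = λ v v∉ w → trans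
                   (addEdge-off (λ { (refl , _) → v∉ (here refl) }) (λ { (refl , _) → v∉ (there y∈) }))
                   (R.agree-off v (v∉ ∘ there) w)
  ; start-free = λ ()
  ; end-free   = λ l≡true w → trans (addEdge-off (λ { (refl , _) → x∉ z∈ }) (λ { (z≡y , _) → y≢z (sym z≡y) }))
                                   (R.end-free l≡true w)
  ; size       = size-after-adding l
                   (numEdges-addEdge (matching-isGraph R.isMatching) (edge-≢ gH Hxy) (trans (R.agree-off x x∉ y) Mxy))
                   R.size
  }
  where
  module R = Switched R
  x-free′ : Unmatched R.matching x
  x-free′ w = trans (R.agree-off x x∉ w) (x-free w)

switch : IsGraph H → IsMatching H M → Alternating M H b l x z vs →
  (b ≡ false → Unmatched M x) → (l ≡ false → Unmatched M z) → Switched H M b l x z vs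
switch {b = true}  gH mM (single Mxy Hxy _) _ _ = switch-single-in mM Mxy
switch {b = false} gH mM (single Mxy Hxy _) x-free z-free = switch-single-out gH mM Mxy Hxy (x-free refl) (z-free refl)
switch {M = M} {b = true} gH mM (cons {x = x} {y} Mxy Hxy x∉ P) _ z-free =
  switch-cons-in mM Mxy x∉ (alternating-start∈ P)
    (switch gH (removeEdge-matching x y mM) P′ (λ _ → removeEdge-freesʳ mM Mxy) (removeEdge-unmatched ∘ z-free))
  where
  P′ = alternating-cong (λ u v u∈ v∈ → removeEdge-off (λ { (refl , _) → x∉ u∈ }) (λ { (_ , refl) → x∉ v∈ })) P
switch {b = false} gH mM (cons Mxy Hxy x∉ P) x-free z-free =
  switch-cons-out gH Mxy Hxy x∉ (alternating-start∈ P) (alternating-end∈ P) (alternating-ends-≢ P) (x-free refl)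
    (switch gH mM P (λ ()) z-free)

switch-grows : (S : Switched H M false false x z vs) → numEdges M < numEdges (Switched.matching S)
switch-grows {M = M} S =
  subst (numEdges M <_) (trans (sym (ℕP.+-comm (numEdges M) 1)) (trans (sym (Switched.size S)) (ℕP.+-identityʳ _)))
    (ℕP.n<1+n (numEdges M))

switch-keeps : ∀ b → (S : Switched H M b (not b) x z vs) → numEdges M ≤ numEdges (Switched.matching S)
switch-keeps true  S = ℕP.≤-reflexive (ℕP.+-cancelʳ-≡ 0 _ _ (sym (Switched.size S)))
switch-keeps false S = ℕP.≤-reflexive (ℕP.+-cancelʳ-≡ 0 _ _ (sym (Switched.size S)))

pick : Graph n → Graph n → Bool → Graph n
pick M N true  = M
pick M N false = N

-- Alternating₂ M N t l x z vs: a path from x to z through the distinct vertices vs whose edges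
-- lie alternately in M ∖ N and N ∖ M; the first edge is in M iff t, the last iff l.
data Alternating₂ (M N : Graph n) : Bool → Bool → Fin n → Fin n → List (Fin n) → Set where
  single : pick M N t x y ≡ true → pick M N (not t) x y ≡ false → x ≢ y →
           Alternating₂ M N t t x y (x ∷ y ∷ [])
  cons   : pick M N t x y ≡ true → pick M N (not t) x y ≡ false → x ∉ vs →
           Alternating₂ M N (not t) l y z vs → Alternating₂ M N t l x z (x ∷ vs)

module _ {H M N : Graph n} (M⊆H : ∀ u v → M u v ≡ true → H u v ≡ true)
         (N⊆H : ∀ u v → N u v ≡ true → H u v ≡ true) where

  alternating₂⇒alternatingˡ : Alternating₂ M N t l x z vs → Alternating M H t l x z vs
  alternating₂⇒alternatingˡ {true}  (single e _ x≢y) = single e (M⊆H _ _ e) x≢y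
  alternating₂⇒alternatingˡ {false} (single e e′ x≢y) = single e′ (N⊆H _ _ e) x≢y
  alternating₂⇒alternatingˡ {true}  (cons e _ x∉ P) = cons e (M⊆H _ _ e) x∉ (alternating₂⇒alternatingˡ P)
  alternating₂⇒alternatingˡ {false} (cons e e′ x∉ P) = cons e′ (N⊆H _ _ e) x∉ (alternating₂⇒alternatingˡ P)

  alternating₂⇒alternatingʳ : Alternating₂ M N t l x z vs → Alternating N H (not t) (not l) x z vs
  alternating₂⇒alternatingʳ {true}  (single e e′ x≢y) = single e′ (M⊆H _ _ e) x≢y
  alternating₂⇒alternatingʳ {false} (single e _ x≢y) = single e (N⊆H _ _ e) x≢y
  alternating₂⇒alternatingʳ {true}  (cons e e′ x∉ P) = cons e′ (M⊆H _ _ e) x∉ (alternating₂⇒alternatingʳ P)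
  alternating₂⇒alternatingʳ {false} (cons e _ x∉ P) = cons e (N⊆H _ _ e) x∉ (alternating₂⇒alternatingʳ P)

_∈?_ : ∀ (v : Fin n) (V : List (Fin n)) → Dec (v ∈ V)
v ∈? V = Any.any? (v ≟_) V

unvisited : List (Fin n) → ℕ
unvisited V = count (λ v → not (does (v ∈? V)))

unvisited-∷ : ∀ {V} → c ∉ V → unvisited V ≡ suc (unvisited (c ∷ V))
unvisited-∷ {c = c} {V} c∉V =
  count-≡suc c (cong not (dec-false (c ∈? V) c∉V)) (cong not (dec-true (c ∈? (c ∷ V)) (here refl))) same
  where
  same : ∀ i → i ≢ c → not (does (i ∈? V)) ≡ not (does (i ∈? (c ∷ V)))
  same i i≢c = cong not (does-⇔ (mk⇔ there λ { (here i≡c) → ⊥-elim (i≢c i≡c) ; (there i∈) → i∈ }) (i ∈? V) (i ∈? (c ∷ V)))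

partner? : ∀ (K : Graph n) (c : Fin n) → (∃ λ w → K c w ≡ true) ⊎ Unmatched K c
partner? K c with FinP.any? (λ w → K c w Bool.≟ true)
... | yes found = inj₁ found
... | no none = inj₂ free
  where
  free : Unmatched K c
  free w with K c w in Kcw
  ... | true  = ⊥-elim (none (w , Kcw))
  ... | false = refl

module Walk {HM HN M N : Graph n} (mM : IsMatching HM M) (mN : IsMatching HN N) where

  pick-sym : ∀ t → pick M N t u v ≡ true → pick M N t v u ≡ true
  pick-sym true  = matching-sym mM
  pick-sym false = matching-sym mN

  pick-≢ : ∀ t → pick M N t u v ≡ true → u ≢ v
  pick-≢ true  = matching-≢ mM
  pick-≢ false = matching-≢ mN

  pick-unique : ∀ t → pick M N t v u ≡ true → pick M N t v w ≡ true → u ≡ w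
  pick-unique true  = matching-unique mM
  pick-unique false = matching-unique mN

  pick-not-not : ∀ t → pick M N (not (not t)) u v ≡ pick M N t u v
  pick-not-not true  = refl
  pick-not-not false = refl

  next-edge-∉-other : ∀ {V c c′} t → c ∉ V → (∀ v → v ∈ V → ∀ w → pick M N t v w ≡ true → w ∈ V) →
    (∀ w → pick M N (not t) c w ≡ true → w ∈ V) → pick M N t c c′ ≡ true → pick M N (not t) c c′ ≡ false
  next-edge-∉-other {c = c} {c′} t c∉V closedₜ c-back e with pick M N (not t) c c′ in e′
  ... | true  = ⊥-elim (c∉V (closedₜ c′ (c-back c′ e′) c (pick-sym t e)))
  ... | false = refl

  Continuation : Bool → Fin n → List (Fin n) → Set
  Continuation t c V = Unmatched (pick M N t) c ⊎
    (∃ λ z → ∃ λ l → ∃ λ vs → Alternating₂ M N t l c z vs × (∀ v → v ∈ vs → v ∉ V) × Unmatched (pick M N (not l)) z)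

  -- V is the set of vertices visited before the current vertex c; the next edge is taken in pick t.
  -- The invariants say that V is closed under both matchings except for the edge leading to c.
  follow : ∀ (fuel : ℕ) (V : List (Fin n)) (c : Fin n) (t : Bool) → c ∉ V →
    (∀ v → v ∈ V → ∀ w → pick M N t v w ≡ true → w ∈ V) →
    (∀ v → v ∈ V → ∀ w → pick M N (not t) v w ≡ true → w ∈ V ⊎ w ≡ c) →
    (∀ w → pick M N (not t) c w ≡ true → w ∈ V) → unvisited V ≤ fuel → Continuation t c V
  follow fuel V c t c∉V closedₜ closedₙₜ c-back fuel-ok with partner? (pick M N t) c
  ... | inj₂ c-free = inj₁ c-free
  follow zero V c t c∉V closedₜ closedₙₜ c-back fuel-ok | inj₁ (c′ , e) rewrite unvisited-∷ c∉V with fuel-ok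
  ... | ()
  follow (suc fuel) V c t c∉V closedₜ closedₙₜ c-back fuel-ok | inj₁ (c′ , e)
    with follow fuel (c ∷ V) c′ (not t) c′∉ closed′ₜ closed′ₙₜ c′-back fuel-ok′
    where
    c′∉V : c′ ∉ V
    c′∉V c′∈ = c∉V (closedₜ c′ c′∈ c (pick-sym t e))
    c′∉ : c′ ∉ c ∷ V
    c′∉ (here c′≡c) = pick-≢ t e (sym c′≡c)
    c′∉ (there c′∈) = c′∉V c′∈
    closed′ₜ : ∀ v → v ∈ c ∷ V → ∀ w → pick M N (not t) v w ≡ true → w ∈ c ∷ V
    closed′ₜ v (here refl) w e′ = there (c-back w e′)
    closed′ₜ v (there v∈) w e′ = [ there , here ] (closedₙₜ v v∈ w e′)
    closed′ₙₜ : ∀ v → v ∈ c ∷ V → ∀ w → pick M N (not (not t)) v w ≡ true → w ∈ c ∷ V ⊎ w ≡ c′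
    closed′ₙₜ v (here refl) w e′ = inj₂ (pick-unique t (subst (_≡ true) (pick-not-not t) e′) e)
    closed′ₙₜ v (there v∈) w e′ = inj₁ (there (closedₜ v v∈ w (subst (_≡ true) (pick-not-not t) e′)))
    c′-back : ∀ w → pick M N (not (not t)) c′ w ≡ true → w ∈ c ∷ V
    c′-back w e′ = here (pick-unique t (subst (_≡ true) (pick-not-not t) e′) (pick-sym t e))
    fuel-ok′ : unvisited (c ∷ V) ≤ fuel
    fuel-ok′ = ℕP.≤-pred (subst (_≤ suc fuel) (unvisited-∷ c∉V) fuel-ok)
  ... | inj₁ c′-free = inj₂ (c′ , t , c ∷ c′ ∷ [] , single e (next-edge-∉-other t c∉V closedₜ c-back e) (pick-≢ t e) , disjoint , c′-free)
    where
    disjoint : ∀ v → v ∈ c ∷ c′ ∷ [] → v ∉ V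
    disjoint v (here refl) = c∉V
    disjoint v (there (here refl)) v∈ = c∉V (closedₜ v v∈ c (pick-sym t e))
  ... | inj₂ (z , l , vs , P , disjoint , z-free) =
    inj₂ (z , l , c ∷ vs , cons e (next-edge-∉-other t c∉V closedₜ c-back e) (λ c∈ → disjoint c c∈ (here refl)) P , disjoint′ , z-free)
    where
    disjoint′ : ∀ v → v ∈ c ∷ vs → v ∉ V
    disjoint′ v (here refl) = c∉V
    disjoint′ v (there v∈) v∈V = disjoint v v∈ (there v∈V)

  maximal-path : ∀ t (y : Fin n) → Unmatched (pick M N (not t)) y →
    Unmatched (pick M N t) y ⊎
    (∃ λ z → ∃ λ l → ∃ λ vs → Alternating₂ M N t l y z vs × Unmatched (pick M N (not l)) z)
  maximal-path t y y-free
    with follow (unvisited {n} []) [] y t (λ ()) (λ _ ()) (λ _ ())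
                (λ w e → ⊥-elim (true≢false (trans (sym e) (y-free w)))) ℕP.≤-refl
  ... | inj₁ y-freeₜ = inj₁ y-freeₜ
  ... | inj₂ (z , l , vs , P , _ , z-free) = inj₂ (z , l , vs , P , z-free)

-- Membership in D quantifies over all matchings; the case analyses below decide it by exhaustive
-- search over Graph n.
Searchable : (X : Set) → (X → X → Set) → Set₁
Searchable X _≈_ = ∀ (P : X → Set) → (∀ x → Dec (P x)) → (∀ {x y} → x ≈ y → P x → P y) → Dec (∃ P)

Pointwise : ∀ {X : Set} {m} → (X → X → Set) → (Fin m → X) → (Fin m → X) → Set
Pointwise _≈_ f g = ∀ i → f i ≈ g i

Bool-searchable : Searchable Bool _≡_
Bool-searchable P P? _ with P? true | P? false
... | yes p | _     = yes (true , p)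
... | no _  | yes p = yes (false , p)
... | no ¬p | no ¬q = no λ { (true , p) → ¬p p ; (false , q) → ¬q q }

fcons : ∀ {X : Set} {m} → X → (Fin m → X) → Fin (suc m) → X
fcons x g zero    = x
fcons x g (suc i) = g i

Fun-searchable : ∀ {X : Set} {_≈_ : X → X → Set} (m : ℕ) → Searchable X _≈_ → (∀ x → x ≈ x) →
  Searchable (Fin m → X) (Pointwise _≈_)
Fun-searchable zero _ _ P P? resp with P? (λ ())
... | yes p = yes (_ , p)
... | no ¬p = no λ { (f , pf) → ¬p (resp (λ ()) pf) }
Fun-searchable {X = X} {_≈_} (suc m) X-search ≈-refl P P? resp
  with X-search (λ x → ∃ λ g → P (fcons x g)) head? head-resp
  where
  head? : ∀ x → Dec (∃ λ g → P (fcons x g))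
  head? x = Fun-searchable m X-search ≈-refl (P ∘ fcons x) (P? ∘ fcons x)
              λ g≈g′ → resp λ { zero → ≈-refl x ; (suc i) → g≈g′ i }
  head-resp : ∀ {x y} → x ≈ y → (∃ λ g → P (fcons x g)) → ∃ λ g → P (fcons y g)
  head-resp x≈y (g , p) = g , resp (λ { zero → x≈y ; (suc i) → ≈-refl (g i) }) p
... | yes (x , g , p) = yes (fcons x g , p)
... | no ¬p = no λ { (f , pf) → ¬p (f zero , f ∘ suc , resp (λ { zero → ≈-refl (f zero) ; (suc i) → ≈-refl (f (suc i)) }) pf) }

Graph-searchable : ∀ n → Searchable (Graph n) (Pointwise (Pointwise _≡_))
Graph-searchable n = Fun-searchable n (Fun-searchable n Bool-searchable λ _ → refl) λ _ _ → refl

IsMatching-cong : (∀ u v → M u v ≡ K u v) → IsMatching H M → IsMatching H K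
IsMatching-cong M≗K mM =
  (((λ u v → trans (sym (M≗K u v)) (trans (proj₁ (matching-isGraph mM) u v) (M≗K v u))) ,
    (λ v → trans (sym (M≗K v v)) (proj₂ (matching-isGraph mM) v))) ,
   (λ u v → matching⊆ mM u v ∘ trans (M≗K u v))) ,
  (λ v u w e₁ e₂ → matching-unique mM (trans (M≗K v u) e₁) (trans (M≗K v w) e₂))

IsMaxMatching-cong : (∀ u v → M u v ≡ K u v) → IsMaxMatching H M → IsMaxMatching H K
IsMaxMatching-cong M≗K (mM , max) =
  IsMatching-cong M≗K mM , λ M′ mM′ → subst (numEdges M′ ≤_) (numEdges-cong M≗K) (max M′ mM′)

isMatching? : ∀ (H M : Graph n) → Dec (IsMatching H M)
isMatching? H M =
  ((FinP.all? (λ u → FinP.all? λ v → M u v Bool.≟ M v u) ×-dec FinP.all? (λ v → M v v Bool.≟ false)) ×-dec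
    FinP.all? (λ u → FinP.all? λ v → (M u v Bool.≟ true) →-dec (H u v Bool.≟ true))) ×-dec
  FinP.all? (λ v → FinP.all? λ u → FinP.all? λ w → (M v u Bool.≟ true) →-dec ((M v w Bool.≟ true) →-dec (u ≟ w)))

isMaxMatching? : ∀ (H M : Graph n) → Dec (IsMaxMatching H M)
isMaxMatching? {n} H M with isMatching? H M
... | no ¬mM = no (¬mM ∘ proj₁)
... | yes mM with Graph-searchable n (λ K → IsMatching H K × numEdges M < numEdges K)
                    (λ K → isMatching? H K ×-dec (numEdges M ℕP.<? numEdges K))
                    (λ M≈K (mK , M<K) → IsMatching-cong (λ u v → M≈K u v) mK ,
                                         subst (numEdges M <_) (numEdges-cong λ u v → M≈K u v) M<K)
...   | yes (K , mK , M<K) = no λ mx → maximum-≮ mx mK M<K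
...   | no ¬bigger = yes (mM , λ K mK → ℕP.≮⇒≥ λ M<K → ¬bigger (K , mK , M<K))

GE-D? : ∀ (H : Graph n) v → Dec (GE-D H v)
GE-D? {n} H v = Graph-searchable n (λ M → IsMaxMatching H M × Unmatched M v)
  (λ M → isMaxMatching? H M ×-dec FinP.all? (λ w → M v w Bool.≟ false))
  (λ M≈K (mx , v-free) → IsMaxMatching-cong (λ a c → M≈K a c) mx , λ w → trans (sym (M≈K v w)) (v-free w))

GE-A? : ∀ (H : Graph n) v → Dec (GE-A H v)
GE-A? H v with GE-D? H v
... | yes v∈D = no λ v∈A → proj₁ v∈A v∈D
... | no v∉D with FinP.any? (λ u → GE-D? H u ×-dec (H v u Bool.≟ true))
...   | yes nbr = yes (v∉D , nbr)
...   | no ¬nbr = no (¬nbr ∘ proj₂)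

¬augmenting : IsGraph H → IsMaxMatching H M → Alternating M H false false x z vs →
  Unmatched M x → Unmatched M z → ⊥
¬augmenting gH mx P x-free z-free = maximum-≮ mx S.isMatching (switch-grows S)
  where
  S = switch gH (proj₁ mx) P (λ _ → x-free) (λ _ → z-free)
  module S = Switched S

¬free-edge : IsGraph H → IsMaxMatching H M → H u v ≡ true → Unmatched M u → Unmatched M v → ⊥
¬free-edge gH mx Huv u-free v-free =
  ¬augmenting gH mx (single (unmatched-partner (proj₁ mx) v-free) Huv (edge-≢ gH Huv)) u-free v-free

alternating⇒D : IsGraph H → IsMaxMatching H M → Alternating M H true false v z vs → Unmatched M z → GE-D H v
alternating⇒D gH mx P z-free = S.matching , maximum-≤ mx S.isMatching (switch-keeps true S) , S.start-free refl
  where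
  S = switch gH (proj₁ mx) P (λ ()) (λ _ → z-free)
  module S = Switched S

matched-of-¬D : ¬ GE-D H a → IsMaxMatching H M → ∃ λ w → M a w ≡ true
matched-of-¬D {a = a} {M = M} a∉D mx with partner? M a
... | inj₁ found  = found
... | inj₂ a-free = ⊥-elim (a∉D (M , mx , a-free))

isolated-unmatched : IsMatching (isolate H a) K → Unmatched K a
isolated-unmatched {a = a} {K = K} mK w with K a w in Kaw
... | true  = ⊥-elim (true≢false (trans (sym (matching⊆ mK a w Kaw)) isolate-a))
... | false = refl

removeEdge-matching-isolate : IsMatching H M → M a s ≡ true → IsMatching (isolate H a) (removeEdge M a s)
removeEdge-matching-isolate {H = H} {M} {a} {s} mM Mas =
  (removeEdge-isGraph a s (matching-isGraph mM) , sub) , proj₂ (removeEdge-matching a s mM)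
  where
  sub : ∀ u v → removeEdge M a s u v ≡ true → isolate H a u v ≡ true
  sub u v e = trans (isolate-off u≢a v≢a) (matching⊆ mM u v Muv)
    where
    Muv : M u v ≡ true
    Muv = removeEdge⊆ e
    u≢a : u ≢ a
    u≢a refl with refl ← matching-unique mM Mas Muv = true≢false (trans (sym e) removeEdge-ac)
    v≢a : v ≢ a
    v≢a refl with refl ← matching-unique mM Mas (matching-sym mM Muv) = true≢false (trans (sym e) removeEdge-ca)

isolate-maximum : IsMaxMatching H M → ¬ GE-D H a → M a s ≡ true →
  IsMaxMatching (isolate H a) (removeEdge M a s)
isolate-maximum {H = H} {M} {a} {s} mx a∉D Mas = removeEdge-matching-isolate (proj₁ mx) Mas , bounded
  where
  bounded : ∀ K → IsMatching (isolate H a) K → numEdges K ≤ numEdges (removeEdge M a s)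
  bounded K mK = ℕP.≮⇒≥ λ M-1<K →
    a∉D (K , maximum-≤ mx (sub-matching (λ _ _ → isolate⊆) mK)
                (subst (_≤ numEdges K) (sym (numEdges-removeEdge (matching-isGraph (proj₁ mx)) Mas)) M-1<K) ,
         isolated-unmatched mK)

D⊆D-isolate : ¬ GE-D H a → GE-D H x → GE-D (isolate H a) x
D⊆D-isolate {a = a} a∉D (N , mx , x-free) with matched-of-¬D a∉D mx
... | w , Naw = removeEdge N a w , isolate-maximum mx a∉D Naw , removeEdge-unmatched x-free

-- For a ∈ A the converse inclusion holds off a: an N-augmenting path for a maximum N of H − a
-- must end at a, and then continues along an H-edge from a into D.
D-isolate⊆D : IsGraph H → GE-A H a → c ≢ a → GE-D (isolate H a) c → GE-D H c
D-isolate⊆D {H = H} {a} {c} gH (a∉D , y , (M , mx , y-free) , Hay) c≢a (N , mxN , c-free)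
  with matched-of-¬D a∉D mx
... | w , Maw with Walk.maximal-path (proj₁ mx) (proj₁ mxN) true c c-free
...   | inj₁ c-freeᴹ = M , mx , c-freeᴹ
...   | inj₂ (z , false , vs , P , z-free) =
  alternating⇒D gH mx (alternating₂⇒alternatingˡ (matching⊆ (proj₁ mx)) N⊆H P) z-free
  where
  N⊆H : ∀ u v → N u v ≡ true → H u v ≡ true
  N⊆H u v = isolate⊆ ∘ matching⊆ (proj₁ mxN) u v
...   | inj₂ (z , true , vs , P , z-free) = ends-at-a
  where
  mM = proj₁ mx
  mN : IsMatching H N
  mN = sub-matching (λ _ _ → isolate⊆) (proj₁ mxN)
  Pᴹ = alternating₂⇒alternatingˡ (matching⊆ mM) (matching⊆ mN) P
  Pᴺ = alternating₂⇒alternatingʳ (matching⊆ mM) (matching⊆ mN) P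
  a-freeᴺ : Unmatched N a
  a-freeᴺ = isolated-unmatched (proj₁ mxN)
  S = switch gH mN Pᴺ (λ _ → c-free) (λ _ → z-free)
  module S = Switched S
  mxS : IsMaxMatching H S.matching
  mxS = maximum-≤ mx S.isMatching
          (subst (_≤ numEdges S.matching) (sym (numEdges-removeEdge (matching-isGraph mM) Maw))
            (ℕP.≤-trans (s≤s (proj₂ mxN _ (removeEdge-matching-isolate mM Maw))) (switch-grows S)))
  y∉vs : y ∉ vs
  y∉vs y∈vs with alternating-unmatched mM Pᴹ y∈vs y-free
  ... | inj₁ (_ , ())
  ... | inj₂ (_ , ())
  ends-at-a : GE-D H c
  ends-at-a with a ∈? vs
  ... | no a∉vs = ⊥-elim (a∉D (S.matching , mxS , λ w → trans (S.agree-off a a∉vs w) (a-freeᴺ w)))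
  ... | yes a∈vs with alternating-unmatched mN Pᴺ a∈vs a-freeᴺ
  ...   | inj₁ (refl , _) = ⊥-elim (c≢a refl)
  ...   | inj₂ (refl , _) = alternating⇒D gH mx (alternating-snoc Pᴹ (unmatched-partner mM y-free) Hay y∉vs) y-free

matched-on-alternating⇒D : IsGraph H → IsMaxMatching H M → Alternating M H true false x z vs →
  Unmatched M z → v ∈ vs → M v w ≡ true → GE-D H v ⊎ GE-D H w
matched-on-alternating⇒D {w = w} gH mx P z-free v∈ Mvw with alternating-suffix (proj₁ mx) P v∈ Mvw
... | inj₁ (_ , from-v) = inj₁ (alternating⇒D gH mx from-v z-free)
... | inj₂ (inj₁ (_ , from-w)) = inj₂ (alternating⇒D gH mx from-w z-free)
... | inj₂ (inj₂ (inj₁ (_ , ())))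
... | inj₂ (inj₂ (inj₂ (refl , _))) = ⊥-elim (true≢false (trans (sym Mvw) (z-free w)))

A-partner∈D : IsGraph H → GE-A H a → IsMaxMatching H M → M a w ≡ true → GE-D H w
A-partner∈D {H = H} {a} {M} {w} gH (a∉D , u , u∈D@(N , mxN , u-free) , Hau) mx Maw with w ≟ u
... | yes refl = u∈D
... | no w≢u with Walk.maximal-path (proj₁ mx) (proj₁ mxN) true u u-free
...   | inj₁ u-freeᴹ = alternating⇒D gH mx (cons Mwa (matching⊆ mM w a Mwa) w∉ (single Mau Hau a≢u)) u-freeᴹ
  where
  mM = proj₁ mx
  Mwa = matching-sym mM Maw
  Mau : M a u ≡ false
  Mau = unmatched-partner mM u-freeᴹ
  a≢u : a ≢ u
  a≢u refl = a∉D u∈D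
  w∉ : w ∉ a ∷ u ∷ []
  w∉ (here w≡a) = matching-≢ mM Maw (sym w≡a)
  w∉ (there (here w≡u)) = w≢u w≡u
...   | inj₂ (z , true , vs , P , z-free) =
  ⊥-elim (¬augmenting gH mxN (alternating₂⇒alternatingʳ (matching⊆ (proj₁ mx)) (matching⊆ (proj₁ mxN)) P) u-free z-free)
...   | inj₂ (z , false , vs , P , z-free) = through-path
  where
  mM = proj₁ mx
  Pᴹ = alternating₂⇒alternatingˡ (matching⊆ mM) (matching⊆ (proj₁ mxN)) P
  Mwa = matching-sym mM Maw
  through-path : GE-D H w
  through-path with a ∈? vs | w ∈? vs
  ... | yes a∈vs | _ = [ ⊥-elim ∘ a∉D , (λ w∈D → w∈D) ] (matched-on-alternating⇒D gH mx Pᴹ z-free a∈vs Maw)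
  ... | no _ | yes w∈vs = [ (λ w∈D → w∈D) , ⊥-elim ∘ a∉D ] (matched-on-alternating⇒D gH mx Pᴹ z-free w∈vs Mwa)
  ... | no a∉vs | no w∉vs = alternating⇒D gH mx (cons Mwa (matching⊆ mM w a Mwa) w∉ (cons Mau Hau a∉vs Pᴹ)) z-free
    where
    Mau : M a u ≡ false
    Mau with M a u in e
    ... | true  = ⊥-elim (w≢u (matching-unique mM Maw e))
    ... | false = refl
    w∉ : w ∉ a ∷ vs
    w∉ (here w≡a) = matching-≢ mM Maw (sym w≡a)
    w∉ (there w∈) = w∉vs w∈

sameCompD-D : SameCompD H u v → GE-D H u
sameCompD-D (here u∈D)     = u∈D
sameCompD-D (step u∈D _ _) = u∈D

sameCompD-snoc : SameCompD H u v → H v w ≡ true → GE-D H w → SameCompD H u w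
sameCompD-snoc (here u∈D) Huw w∈D = step u∈D Huw (here w∈D)
sameCompD-snoc (step u∈D Hux rest) Hvw w∈D = step u∈D Hux (sameCompD-snoc rest Hvw w∈D)

sameCompD-sym : IsGraph H → SameCompD H u v → SameCompD H v u
sameCompD-sym gH (here u∈D) = here u∈D
sameCompD-sym gH (step u∈D Hux rest) = sameCompD-snoc (sameCompD-sym gH rest) (edge-sym gH Hux) u∈D

sameCompD-trans : SameCompD H u v → SameCompD H v w → SameCompD H u w
sameCompD-trans (here _) r = r
sameCompD-trans (step u∈D Hux rest) r = step u∈D Hux (sameCompD-trans rest r)

sameCompD-isolate : IsGraph H → ¬ GE-D H a → SameCompD H u v → SameCompD (isolate H a) u v
sameCompD-isolate gH a∉D (here u∈D) = here (D⊆D-isolate a∉D u∈D)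
sameCompD-isolate {a = a} gH a∉D (step {u} {x} u∈D Hux rest) =
  step (D⊆D-isolate a∉D u∈D) (trans (isolate-off u≢a x≢a) Hux) (sameCompD-isolate gH a∉D rest)
  where
  u≢a : u ≢ a
  u≢a refl = a∉D u∈D
  x≢a : x ≢ a
  x≢a refl = a∉D (sameCompD-D rest)

-- Walking along the component from u towards v, each step trades the current maximum matching for
-- another one (switching along a path of M Δ N) that leaves the next vertex free.
¬sameCompD-unmatched : IsGraph H → SameCompD H u v → IsMaxMatching H M → Unmatched M u → Unmatched M v → u ≢ v → ⊥
¬sameCompD-unmatched gH (here _) mx u-free v-free u≢v = u≢v refl
¬sameCompD-unmatched {H = H} {u} {v} gH (step {w = w} _ Huw rest) mx u-free v-free u≢v with w ≟ v
... | yes refl = ¬free-edge gH mx Huw u-free v-free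
... | no w≢v with sameCompD-D rest
...   | N , mxN , w-freeᴺ with Walk.maximal-path (proj₁ mx) (proj₁ mxN) false u u-free
...     | inj₁ u-freeᴺ = ¬free-edge gH mxN Huw u-freeᴺ w-freeᴺ
...     | inj₂ (z , false , vs , P , z-free) =
  ¬augmenting gH mx (alternating₂⇒alternatingˡ (matching⊆ (proj₁ mx)) (matching⊆ (proj₁ mxN)) P) u-free z-free
...     | inj₂ (z , true , vs , P , z-free) = via-z
  where
  mM = proj₁ mx
  mN = proj₁ mxN
  Pᴹ = alternating₂⇒alternatingˡ (matching⊆ mM) (matching⊆ mN) P
  Pᴺ = alternating₂⇒alternatingʳ (matching⊆ mM) (matching⊆ mN) P
  S = switch gH mN Pᴺ (λ ()) (λ _ → z-free)
  module S = Switched S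
  mxS : IsMaxMatching H S.matching
  mxS = maximum-≤ mxN S.isMatching (switch-keeps true S)
  via-z : ⊥
  via-z with w ∈? vs
  ... | no w∉vs = ¬free-edge gH mxS Huw (S.start-free refl) w-freeˢ
    where
    w-freeˢ : Unmatched S.matching w
    w-freeˢ y = trans (S.agree-off w w∉vs y) (w-freeᴺ y)
  ... | yes w∈vs with alternating-unmatched mN Pᴺ w∈vs w-freeᴺ
  ...   | inj₁ (_ , ())
  ...   | inj₂ (refl , _) = ¬sameCompD-unmatched gH rest (maximum-≤ mx R.isMatching (switch-keeps false R)) (R.end-free refl) v-freeᴿ w≢v
    where
    R = switch gH mM Pᴹ (λ _ → u-free) (λ ())
    module R = Switched R
    v-freeᴿ : Unmatched R.matching v
    v-freeᴿ y with v ∈? vs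
    ... | no v∉vs = trans (R.agree-off v v∉vs y) (v-free y)
    ... | yes v∈vs with alternating-unmatched mM Pᴹ v∈vs v-free
    ...   | inj₁ (refl , _) = ⊥-elim (u≢v refl)
    ...   | inj₂ (_ , ())

-- Induction on |M|: if a special vertex s is matched to a ∈ A, pass to H − a with the matching
-- M − {a, s}, in which s becomes free while D, the component and the other special survive.
¬distinct-specials : ∀ m → IsGraph H → IsMaxMatching H M → numEdges M ≡ m →
  Special H M s → Special H M c → SameCompD H s c → s ≢ c → ⊥
¬distinct-specials-matched : ∀ m → IsGraph H → IsMaxMatching H M → numEdges M ≡ m →
  GE-D H s → M s a ≡ true → GE-A H a → Special H M c → SameCompD H s c → s ≢ c → ⊥

¬distinct-specials m gH mx |M| (_ , inj₁ s-free) (_ , inj₁ c-free) s~c s≢c = ¬sameCompD-unmatched gH s~c mx s-free c-free s≢c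
¬distinct-specials m gH mx |M| (s∈D , inj₂ (a , Msa , a∈A)) c-special s~c s≢c =
  ¬distinct-specials-matched m gH mx |M| s∈D Msa a∈A c-special s~c s≢c
¬distinct-specials m gH mx |M| s-special@(_ , inj₁ _) (c∈D , inj₂ (a , Mca , a∈A)) s~c s≢c =
  ¬distinct-specials-matched m gH mx |M| c∈D Mca a∈A s-special (sameCompD-sym gH s~c) (s≢c ∘ sym)

¬distinct-specials-matched zero gH mx |M| s∈D Msa a∈A c-special s~c s≢c
  with () ← trans (sym |M|) (numEdges-removeEdge (matching-isGraph (proj₁ mx)) Msa)
¬distinct-specials-matched {H = H} {M} {s} {a} {c} (suc m) gH mx |M| s∈D Msa a∈A@(a∉D , _) (c∈D , c-kind) s~c s≢c =
  ¬distinct-specials m (isolate-isGraph gH) mx′ |M′| s-special′ (D⊆D-isolate a∉D c∈D , c-kind′ c-kind)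
    (sameCompD-isolate gH a∉D s~c) s≢c
  where
  mM = proj₁ mx
  Mas = matching-sym mM Msa
  M′ = removeEdge M a s
  mx′ : IsMaxMatching (isolate H a) M′
  mx′ = isolate-maximum mx a∉D Mas
  |M′| : numEdges M′ ≡ m
  |M′| = ℕP.suc-injective (trans (sym (numEdges-removeEdge (matching-isGraph mM) Mas)) |M|)
  s-special′ : Special (isolate H a) M′ s
  s-special′ = D⊆D-isolate a∉D s∈D , inj₁ (removeEdge-freesʳ mM Mas)
  c≢a : c ≢ a
  c≢a refl = a∉D c∈D
  c-kind′ : (Unmatched M c ⊎ ∃ λ b → M c b ≡ true × GE-A H b) →
    Unmatched M′ c ⊎ ∃ λ b → M′ c b ≡ true × GE-A (isolate H a) b
  c-kind′ (inj₁ c-free) = inj₁ (removeEdge-unmatched c-free)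
  c-kind′ (inj₂ (b , Mcb , b∉D , _)) = inj₂ (b , M′cb , b∉D′ , c , D⊆D-isolate a∉D c∈D , H′bc)
    where
    b≢a : b ≢ a
    b≢a refl = s≢c (matching-unique mM Mas (matching-sym mM Mcb))
    M′cb : M′ c b ≡ true
    M′cb = trans (removeEdge-off (λ { (c≡a , _) → c≢a c≡a }) (λ { (c≡s , _) → s≢c (sym c≡s) })) Mcb
    b∉D′ : ¬ GE-D (isolate H a) b
    b∉D′ = b∉D ∘ D-isolate⊆D gH a∈A b≢a
    H′bc : isolate H a b c ≡ true
    H′bc = trans (isolate-off b≢a c≢a) (matching⊆ mM b c (matching-sym mM Mcb))

special-unique : IsGraph H → IsMaxMatching H M → Special H M s → Special H M c → SameCompD H s c → s ≡ c
special-unique {s = s} {c = c} gH mx s-special c-special s~c with s ≟ c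
... | yes s≡c = s≡c
... | no s≢c = ⊥-elim (¬distinct-specials _ gH mx refl s-special c-special s~c s≢c)

twice : ℕ → ℕ
twice zero    = zero
twice (suc t) = suc (suc (twice t))

twice-mono-≤ : ∀ {i j} → i ≤ j → twice i ≤ twice j
twice-mono-≤ z≤n       = z≤n
twice-mono-≤ (s≤s i≤j) = s≤s (s≤s (twice-mono-≤ i≤j))

twice-injective : ∀ {i j} → twice i ≡ twice j → i ≡ j
twice-injective {zero}  {zero}  _ = refl
twice-injective {suc i} {suc j} e = cong suc (twice-injective (ℕP.suc-injective (ℕP.suc-injective e)))

twice≢suc-twice : ∀ i j → twice i ≢ suc (twice j)
twice≢suc-twice (suc i) (suc j) e = twice≢suc-twice i j (ℕP.suc-injective (ℕP.suc-injective e))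

twice≡2* : ∀ k → twice k ≡ 2 * k
twice≡2* zero    = refl
twice≡2* (suc k) = cong suc (trans (cong suc (twice≡2* k)) (sym (ℕP.+-suc k (k + 0))))

suc-twice%2≡1 : ∀ t → suc (twice t) % 2 ≡ 1
suc-twice%2≡1 zero    = refl
suc-twice%2≡1 (suc t) =
  trans (cong (_% 2) (ℕP.+-comm 2 (suc (twice t)))) (trans ([m+n]%n≡m%n (suc (twice t)) 2) (suc-twice%2≡1 t))

suc-twice-∸-twice : ∀ i j → suc (twice (i + j)) ∸ twice i ≡ suc (twice j)
suc-twice-∸-twice zero    j = refl
suc-twice-∸-twice (suc i) j = suc-twice-∸-twice i j

suc-twice-∸-suc-twice : ∀ i j → suc (twice (i + j)) ∸ suc (twice i) ≡ twice j
suc-twice-∸-suc-twice zero    j = refl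
suc-twice-∸-suc-twice (suc i) j = suc-twice-∸-suc-twice i j

record AugmentingWalk (M : Graph n) (k : ℕ) : Set where
  field
    vertex     : ℕ → Fin n
    injective  : ∀ i j → i ≤ suc (twice k) → j ≤ suc (twice k) → vertex i ≡ vertex j → i ≡ j
    odd-edge   : ∀ t → t < k → M (vertex (suc (twice t))) (vertex (suc (suc (twice t)))) ≡ true
    start-free : Unmatched M (vertex 0)
    end-free   : Unmatched M (vertex (suc (twice k)))

reverse : IsMatching H M → ∀ {k} → AugmentingWalk M k → AugmentingWalk M k
reverse {M = M} mM {k} W = record
  { vertex     = λ i → q (last ∸ i)
  ; injective  = λ i j i≤ j≤ e → ℕP.∸-cancelˡ-≡ i≤ j≤ (injective _ _ (ℕP.m∸n≤m last i) (ℕP.m∸n≤m last j) e)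
  ; odd-edge   = odd-edge′
  ; start-free = end-free
  ; end-free   = subst (Unmatched M ∘ q) (sym (ℕP.n∸n≡0 last)) start-free
  }
  where
  open AugmentingWalk W renaming (vertex to q)
  last : ℕ
  last = suc (twice k)
  odd-edge′ : ∀ t → t < k → M (q (last ∸ suc (twice t))) (q (last ∸ suc (suc (twice t)))) ≡ true
  odd-edge′ t t<k =
    subst₂ (λ i j → M (q i) (q j) ≡ true) (sym from-end) (sym from-end′) (matching-sym mM (odd-edge r r<k))
    where
    r = k ∸ suc t
    k≡ : suc t + r ≡ k
    k≡ = ℕP.m+[n∸m]≡n t<k
    from-end : last ∸ suc (twice t) ≡ suc (suc (twice r))
    from-end = trans (cong (λ m → suc (twice m) ∸ suc (twice t)) (sym (trans (ℕP.+-suc t r) k≡)))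
                     (suc-twice-∸-suc-twice t (suc r))
    from-end′ : last ∸ suc (suc (twice t)) ≡ suc (twice r)
    from-end′ = trans (cong (λ m → suc (twice m) ∸ twice (suc t)) (sym k≡)) (suc-twice-∸-twice (suc t) r)
    r<k : r < k
    r<k = subst (r <_) k≡ (s≤s (ℕP.m≤n+m r t))

SuitableEdge : Graph n → Fin n → Fin n → Set
SuitableEdge H x y = H x y ≡ false × ¬ GE-A H x × ¬ GE-A H y

¬A-neighbour-of-D : GE-D H u → H v u ≡ true → ¬ GE-A H v → GE-D H v
¬A-neighbour-of-D {H = H} {v = v} u∈D Hvu v∉A with GE-D? H v
... | yes v∈D = v∈D
... | no v∉D  = ⊥-elim (v∉A (v∉D , _ , u∈D , Hvu))

module Scan {H M : Graph n} (gH : IsGraph H) (mx : IsMaxMatching H M) {k} (W : AugmentingWalk M k) where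
  open AugmentingWalk W renaming (vertex to q)

  Reached : ℕ → Set
  Reached t = GE-D H (q (twice t)) ×
    ∃ λ s → Special H M s × SameCompD H (q (twice t)) s × ∃ λ i → i ≤ twice t × q i ≡ s

  Found : Set
  Found = ∃ λ t → t ≤ k × SuitableEdge H (q (twice t)) (q (suc (twice t))) × Reached t

  mM : IsMatching H M
  mM = proj₁ mx

  no-later-special : ∀ {t j s} → t ≤ k → Special H M s → (∃ λ i → i ≤ twice t × q i ≡ s) →
    twice t < j → j ≤ suc (twice k) → Special H M (q j) → SameCompD H (q j) s → ⊥
  no-later-special {t} {j} t≤k s-special (i , i≤ , qi≡s) 2t<j j≤ qj-special qj~s
    with refl ← special-unique gH mx qj-special s-special qj~s =
    ℕP.<-irrefl (injective i j (ℕP.≤-trans i≤ (ℕP.m≤n⇒m≤1+n (twice-mono-≤ t≤k))) j≤ qi≡s) (ℕP.≤-<-trans i≤ 2t<j)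

  start-reached : Reached 0
  start-reached = q₀∈D , q 0 , (q₀∈D , inj₁ start-free) , here q₀∈D , 0 , z≤n , refl
    where
    q₀∈D : GE-D H (q 0)
    q₀∈D = M , mx , start-free

  through-A : ∀ t → t ≤ k → GE-A H (q (suc (twice t))) → t < k × Reached (suc t)
  through-A t t≤k q₂ₜ₊₁∈A with ℕP.m≤n⇒m<n∨m≡n t≤k
  ... | inj₂ refl = ⊥-elim (proj₁ q₂ₜ₊₁∈A (M , mx , end-free))
  ... | inj₁ t<k = t<k , q₂ₜ₊₂∈D , _ , (q₂ₜ₊₂∈D , inj₂ (_ , matching-sym mM (odd-edge t t<k) , q₂ₜ₊₁∈A)) ,
                   here q₂ₜ₊₂∈D , _ , ℕP.≤-refl , refl
    where
    q₂ₜ₊₂∈D = A-partner∈D gH q₂ₜ₊₁∈A mx (odd-edge t t<k)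

  through-D : ∀ t → t ≤ k → Reached t → H (q (twice t)) (q (suc (twice t))) ≡ true →
    ¬ GE-A H (q (suc (twice t))) → t < k × Reached (suc t)
  through-D t t≤k (q₂ₜ∈D , s , s-special , q₂ₜ~s , at-i) Hq₂ₜq₂ₜ₊₁ q₂ₜ₊₁∉A with ℕP.m≤n⇒m<n∨m≡n t≤k
  ... | inj₂ refl = ⊥-elim (no-later-special t≤k s-special at-i ℕP.≤-refl ℕP.≤-refl (q₂ₜ₊₁∈D , inj₁ end-free) q₂ₜ₊₁~s)
    where
    q₂ₜ₊₁∈D = ¬A-neighbour-of-D q₂ₜ∈D (edge-sym gH Hq₂ₜq₂ₜ₊₁) q₂ₜ₊₁∉A
    q₂ₜ₊₁~s = step q₂ₜ₊₁∈D (edge-sym gH Hq₂ₜq₂ₜ₊₁) q₂ₜ~s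
  ... | inj₁ t<k with GE-A? H (q (suc (suc (twice t))))
  ...   | yes q₂ₜ₊₂∈A =
    ⊥-elim (no-later-special t≤k s-special at-i ℕP.≤-refl (s≤s (twice-mono-≤ t≤k))
             (q₂ₜ₊₁∈D , inj₂ (_ , odd-edge t t<k , q₂ₜ₊₂∈A)) q₂ₜ₊₁~s)
    where
    q₂ₜ₊₁∈D = ¬A-neighbour-of-D q₂ₜ∈D (edge-sym gH Hq₂ₜq₂ₜ₊₁) q₂ₜ₊₁∉A
    q₂ₜ₊₁~s = step q₂ₜ₊₁∈D (edge-sym gH Hq₂ₜq₂ₜ₊₁) q₂ₜ~s
  ...   | no q₂ₜ₊₂∉A = t<k , q₂ₜ₊₂∈D , s , s-special , step q₂ₜ₊₂∈D Hq₂ₜ₊₂q₂ₜ₊₁ q₂ₜ₊₁~s , at-i′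
    where
    q₂ₜ₊₁∈D = ¬A-neighbour-of-D q₂ₜ∈D (edge-sym gH Hq₂ₜq₂ₜ₊₁) q₂ₜ₊₁∉A
    q₂ₜ₊₁~s = step q₂ₜ₊₁∈D (edge-sym gH Hq₂ₜq₂ₜ₊₁) q₂ₜ~s
    Hq₂ₜ₊₂q₂ₜ₊₁ = matching⊆ mM _ _ (matching-sym mM (odd-edge t t<k))
    q₂ₜ₊₂∈D = ¬A-neighbour-of-D q₂ₜ₊₁∈D Hq₂ₜ₊₂q₂ₜ₊₁ q₂ₜ₊₂∉A
    at-i′ : ∃ λ i → i ≤ twice (suc t) × q i ≡ s
    at-i′ = let (i , i≤ , qi≡s) = at-i in i , ℕP.m≤n⇒m≤1+n (ℕP.m≤n⇒m≤1+n i≤) , qi≡s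

  step-or-stop : ∀ t → t ≤ k → Reached t →
    SuitableEdge H (q (twice t)) (q (suc (twice t))) ⊎ (t < k × Reached (suc t))
  step-or-stop t t≤k reached with GE-A? H (q (suc (twice t)))
  ... | yes q₂ₜ₊₁∈A = inj₂ (through-A t t≤k q₂ₜ₊₁∈A)
  ... | no q₂ₜ₊₁∉A with H (q (twice t)) (q (suc (twice t))) in Hq₂ₜq₂ₜ₊₁
  ...   | false = inj₁ (refl , (λ q₂ₜ∈A → proj₁ q₂ₜ∈A (proj₁ reached)) , q₂ₜ₊₁∉A)
  ...   | true  = inj₂ (through-D t t≤k reached Hq₂ₜq₂ₜ₊₁ q₂ₜ₊₁∉A)

  scan : ∀ r t → t + r ≡ k → Reached t → Found
  scan r t t+r≡k reached with step-or-stop t (subst (t ≤_) t+r≡k (ℕP.m≤m+n t r)) reached | r | t+r≡k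
  ... | inj₁ suitable | _ | _ = t , subst (t ≤_) t+r≡k (ℕP.m≤m+n t r) , suitable , reached
  ... | inj₂ (t<k , _) | zero | t+0≡k = ⊥-elim (ℕP.<-irrefl (trans (sym (ℕP.+-identityʳ t)) t+0≡k) t<k)
  ... | inj₂ (_ , reached′) | suc r′ | t+r≡k′ = scan r′ (suc t) (trans (sym (ℕP.+-suc t r′)) t+r≡k′) reached′

  found : Found
  found = scan k 0 refl start-reached

SuitableEdge-sym : IsGraph H → SuitableEdge H x y → SuitableEdge H y x
SuitableEdge-sym {H = H} {x} {y} (H-sym , _) (Hxy , x∉A , y∉A) = trans (H-sym y x) Hxy , y∉A , x∉A

T1-at : Graph n → Graph n → (Fin n → Set) → Fin n → Fin n → Set
T1-at H M OnP x y =
  SuitableEdge H x y × GE-D H x × GE-D H y × ¬ SameCompD H x y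
  × (∃ λ s₁ → Special H M s₁ × SameCompD H x s₁ × OnP s₁)
  × (∃ λ s₂ → Special H M s₂ × SameCompD H y s₂ × OnP s₂)

T2-at : Graph n → Fin n → Fin n → Fin n → Fin n → Set
T2-at H x y x′ y′ =
  SuitableEdge H x y × SuitableEdge H x′ y′ × x ≢ x′ × x ≢ y′ × y ≢ x′ × y ≢ y′

module _ {H M : Graph n} (gH : IsGraph H) (mx : IsMaxMatching H M) {k} (W : AugmentingWalk M k) where
  open AugmentingWalk W renaming (vertex to q)

  private
    last : ℕ
    last = suc (twice k)

  -- The scan of the reversed walk, in the original indexing.
  FromEnd : Set
  FromEnd = ∃ λ r → r ≤ k × SuitableEdge H (q (twice r)) (q (suc (twice r))) × GE-D H (q (suc (twice r))) ×
    ∃ λ s → Special H M s × SameCompD H (q (suc (twice r))) s × ∃ λ j → suc (twice r) ≤ j × j ≤ last × q j ≡ s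

  from-end : FromEnd
  from-end with Scan.found gH mx (reverse (proj₁ mx) W)
  ... | t′ , t′≤k , suitable′ , (D′ , s′ , s′-special , ~s′ , i′ , i′≤ , qi′≡s′) =
    r , r≤k , SuitableEdge-sym gH (subst₂ (λ a b → SuitableEdge H (q a) (q b)) ∸-twice ∸-suc-twice suitable′) ,
    subst (GE-D H ∘ q) ∸-twice D′ , s′ , s′-special , subst (λ a → SameCompD H (q a) s′) ∸-twice ~s′ ,
    last ∸ i′ , subst (_≤ last ∸ i′) ∸-twice (ℕP.∸-monoʳ-≤ last i′≤) , ℕP.m∸n≤m last i′ , qi′≡s′
    where
    r = k ∸ t′
    k≡ : t′ + r ≡ k
    k≡ = ℕP.m+[n∸m]≡n t′≤k
    r≤k : r ≤ k
    r≤k = ℕP.m∸n≤m k t′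
    ∸-twice : last ∸ twice t′ ≡ suc (twice r)
    ∸-twice = trans (cong (λ m → suc (twice m) ∸ twice t′) (sym k≡)) (suc-twice-∸-twice t′ r)
    ∸-suc-twice : last ∸ suc (twice t′) ≡ twice r
    ∸-suc-twice = trans (cong (λ m → suc (twice m) ∸ suc (twice t′)) (sym k≡)) (suc-twice-∸-suc-twice t′ r)

  private
    ≤last : ∀ {t} → t ≤ k → twice t ≤ last
    ≤last t≤k = ℕP.m≤n⇒m≤1+n (twice-mono-≤ t≤k)

    <last : ∀ {t} → t ≤ k → suc (twice t) ≤ last
    <last t≤k = s≤s (twice-mono-≤ t≤k)

  -- If the scans from both ends stop at the same edge, its ends lie in D in components whose special
  -- vertices sit on opposite sides of it; otherwise the two edges are disjoint.
  suitable-edges : (OnP : Fin n → Set) → (∀ i → OnP (q i)) →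
    (∃ λ t → t ≤ k × T1-at H M OnP (q (twice t)) (q (suc (twice t)))) ⊎
    (∃ λ t → ∃ λ r → t ≤ k × r ≤ k × T2-at H (q (twice t)) (q (suc (twice t))) (q (twice r)) (q (suc (twice r))))
  suitable-edges OnP on-walk with Scan.found gH mx W | from-end
  ... | t , t≤k , suitable , q₂ₜ∈D , s , s-special , q₂ₜ~s , i , i≤ , qi≡s
      | r , r≤k , suitable′ , q₂ᵣ₊₁∈D , s′ , s′-special , q₂ᵣ₊₁~s′ , j , j≥ , j≤ , qj≡s′ with t ℕP.≟ r
  ... | yes refl = inj₁ (t , t≤k , suitable , q₂ₜ∈D , q₂ᵣ₊₁∈D , ¬same ,
                         (s , s-special , q₂ₜ~s , subst OnP qi≡s (on-walk i)) ,
                         (s′ , s′-special , q₂ᵣ₊₁~s′ , subst OnP qj≡s′ (on-walk j)))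
    where
    ¬same : ¬ SameCompD H (q (twice t)) (q (suc (twice t)))
    ¬same q₂ₜ~q₂ₜ₊₁
      with refl ← special-unique gH mx s-special s′-special
                    (sameCompD-trans (sameCompD-sym gH q₂ₜ~s) (sameCompD-trans q₂ₜ~q₂ₜ₊₁ q₂ᵣ₊₁~s′)) =
      ℕP.<-irrefl (injective i j (ℕP.≤-trans i≤ (≤last t≤k)) j≤ (trans qi≡s (sym qj≡s′))) (ℕP.≤-<-trans i≤ j≥)
  ... | no t≢r = inj₂ (t , r , t≤k , r≤k , suitable , suitable′ ,
                       (λ e → t≢r (twice-injective (injective _ _ (≤last t≤k) (≤last r≤k) e))) ,
                       (λ e → twice≢suc-twice t r (injective _ _ (≤last t≤k) (<last r≤k) e)) ,
                       (λ e → twice≢suc-twice r t (sym (injective _ _ (<last t≤k) (≤last r≤k) e))) ,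
                       (λ e → t≢r (twice-injective (ℕP.suc-injective (injective _ _ (<last t≤k) (<last r≤k) e)))))

clamp : ∀ m → ℕ → Fin (suc m)
clamp m       zero    = zero
clamp zero    (suc i) = zero
clamp (suc m) (suc i) = suc (clamp m i)

clamp-toℕ : ∀ m (f : Fin (suc m)) → clamp m (toℕ f) ≡ f
clamp-toℕ m       zero    = refl
clamp-toℕ (suc m) (suc f) = cong suc (clamp-toℕ m f)

toℕ-clamp : ∀ m i → i ≤ m → toℕ (clamp m i) ≡ i
toℕ-clamp m       zero    _         = refl
toℕ-clamp (suc m) (suc i) (s≤s i≤m) = cong suc (toℕ-clamp m i i≤m)

clamp-fromℕ : ∀ m → clamp m m ≡ fromℕ m
clamp-fromℕ zero    = refl
clamp-fromℕ (suc m) = cong suc (clamp-fromℕ m)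

module _ {M M⋆ : Graph n} {k} {p : Fin (suc (PathLen k)) → Fin n} (aug : IsAugPath M M⋆ k p) where
  private
    L : ℕ
    L = PathLen k
    last≡L : suc (twice k) ≡ L
    last≡L = cong suc (twice≡2* k)
    q : ℕ → Fin n
    q = p ∘ clamp L
    p-injective : Injective _≡_ _≡_ p
    p-injective = proj₁ aug

  edge : ∀ j → j < L → Fin L
  edge j j<L = fromℕ< j<L

  src-edge : ∀ j (j<L : j < L) → src k p (edge j j<L) ≡ q j
  src-edge j j<L =
    cong p (trans (sym (clamp-toℕ L (inject₁ (edge j j<L)))) (cong (clamp L) (trans (FinP.toℕ-inject₁ _) (FinP.toℕ-fromℕ< j<L))))

  tgt-edge : ∀ j (j<L : j < L) → tgt k p (edge j j<L) ≡ q (suc j)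
  tgt-edge j j<L = cong p (trans (sym (clamp-toℕ L (suc (edge j j<L)))) (cong (clamp L ∘ suc) (FinP.toℕ-fromℕ< j<L)))

  augmenting-walk : AugmentingWalk M k
  augmenting-walk = record
    { vertex     = q
    ; injective  = λ i j i≤ j≤ e → trans (sym (toℕ-clamp L i (≤L i≤))) (trans (cong toℕ (p-injective e)) (toℕ-clamp L j (≤L j≤)))
    ; odd-edge   = odd-edge
    ; start-free = proj₁ (proj₂ (proj₂ (proj₂ aug)))
    ; end-free   = subst (Unmatched M ∘ p) (sym (trans (cong (clamp L) last≡L) (clamp-fromℕ L))) (proj₂ (proj₂ (proj₂ (proj₂ aug))))
    }
    where
    ≤L : ∀ {i} → i ≤ suc (twice k) → i ≤ L
    ≤L {i} = subst (i ≤_) last≡L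
    odd-edge : ∀ t → t < k → M (q (suc (twice t))) (q (suc (suc (twice t)))) ≡ true
    odd-edge t t<k = subst₂ (λ x y → M x y ≡ true) (src-edge _ j<L) (tgt-edge _ j<L)
                       (proj₁ (proj₂ (proj₂ aug)) (edge _ j<L) (trans (cong (_% 2) (FinP.toℕ-fromℕ< j<L)) (suc-twice%2≡1 t)))
      where
      j<L : suc (twice t) < L
      j<L = subst (suc (twice t) <_) last≡L (ℕP.m≤n⇒m≤1+n (twice-mono-≤ t<k))

  private
    twice< : ∀ {t} → t ≤ k → twice t < L
    twice< {t} t≤k = subst (twice t <_) last≡L (s≤s (twice-mono-≤ t≤k))

  T1-from-walk : ∀ {H} t (t≤k : t ≤ k) → T1-at H M (OnPath k p) (q (twice t)) (q (suc (twice t))) → T1 k H M p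
  T1-from-walk {H} t t≤k conds =
    edge _ (twice< t≤k) , subst₂ (T1-at H M (OnPath k p)) (sym (src-edge _ (twice< t≤k))) (sym (tgt-edge _ (twice< t≤k))) conds

  T2-from-walk : ∀ {H} t r (t≤k : t ≤ k) (r≤k : r ≤ k) →
    T2-at H (q (twice t)) (q (suc (twice t))) (q (twice r)) (q (suc (twice r))) → T2 k H p
  T2-from-walk {H} t r t≤k r≤k conds =
    edge _ (twice< t≤k) , edge _ (twice< r≤k) ,
    subst₂ (λ x y → T2-at H x y (src k p (edge _ (twice< r≤k))) (tgt k p (edge _ (twice< r≤k))))
      (sym (src-edge _ (twice< t≤k))) (sym (tgt-edge _ (twice< t≤k)))
      (subst₂ (T2-at H (q (twice t)) (q (suc (twice t)))) (sym (src-edge _ (twice< r≤k))) (sym (tgt-edge _ (twice< r≤k))) conds)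

lemma3p3 : ∀ {n : ℕ} (ε : ℚ.ℚ) (ε>0 : ℚ.0ℚ ℚ.< ε) → ε ℚ.≤ ℚ.1ℚ →
    (β β⁻ : ℕ) → 1 ≤ β⁻ → β⁻ < β →
    BetaLarge ε ε>0 β → BetaMinusLarge ε β β⁻ →
    (G H : Graph n) → IsGraph G → IsEDCS β β⁻ G H →
    (M M⋆ : Graph n) → IsMaxMatching H M → IsMaxMatching G M⋆ →
    (k : ℕ) (p : Fin (suc (PathLen k)) → Fin n) →
    IsAugPath M M⋆ k p →
    T1 k H M p ⊎ T2 k H p
lemma3p3 _ _ _ _ _ _ _ _ _ G H _ ((gH , _) , _) M M⋆ mx _ k p aug =
  Sum.map (λ (t , t≤k , conds) → T1-from-walk {M = M} {M⋆} {k} {p} aug t t≤k conds)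
          (λ (t , r , t≤k , r≤k , conds) → T2-from-walk {M = M} {M⋆} {k} {p} aug t r t≤k r≤k conds)
          (suitable-edges gH mx (augmenting-walk {M = M} {M⋆} {k} {p} aug) (OnPath k p) (λ i → _ , refl))
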